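{- Let $H$ be a homogeneous relation on a finite set $X$. Then $H$ is the standard homogeneous relation of some undirected graph on $X$ if and only if $H$ is graphic; and $H$ is the standard homogeneous relation of some tournament on $X$ if and only if $H$ is tournamental.
   Context: A diverse triple of $X$ is $(x,y,z)\in X^3$ with $x\neq y$, $x\neq z$, written $(x|yz)$. A homogeneous relation $H$ on $X$ is a relation on diverse triples such that for every $x\in X$ the relation $H_x(y,z)\Leftrightarrow H(x|yz)$ is an equivalence relation on $X\setminus\{x\}$. For $A\subseteq X$, $H[A]$ is the restriction of $H$ to diverse triples in $A^3$. The congruence of $x$ (w.r.t. $H$) is the number of equivalence classes of $H_x$; the local congruence of $H$ is the maximum congruence over $x\in X$. $H$ is graphic if its local congruence is at most $2$ and for every 3-element subset $\{a,b,c\}\subseteq X$, $H[\{a,b,c\}]$ has exactly $0$ or $2$ elements of congruence $2$. $H$ is tournamental if its local congruence is at most $2$ and for every 3-element subset $\{a,b,c\}$, $H[\{a,b,c\}]$ has exactly $1$ or $3$ elements of congruence $2$. The standard homogeneous relation $H(G)$ of a (directed) graph $G$ on $X$ is defined by: $H(G)(x|uv)$ holds iff either both or none of $u,v$ are in-neighbours of $x$, and either both or none of $u,v$ are out-neighbours of $x$ (for an undirected graph: both or none of $u,v$ are neighbours of $x$). -}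

module Defs where

open import Data.Nat using (ℕ; zero; suc; _⊔_; _≤_)
open import Data.Fin using (Fin; _≟_; _<?_)
open import Data.Bool using (Bool; true; false; not; _∧_; _xor_; if_then_else_)
open import Data.List using (List; []; _∷_; map; foldr; allFin)
open import Data.Nat.ListAction using (sum)
open import Data.Bool.ListAction using (any)
open import Data.Product using (_×_; Σ)
open import Data.Sum using (_⊎_)
open import Relation.Nullary using (¬_)
open import Relation.Nullary.Decidable using (⌊_⌋)
open import Relation.Binary.PropositionalEquality using (_≡_; _≢_)

-- A (ternary) relation on X = Fin n, given by its characteristic function.
-- `H x y z` is read as H(x|yz). Only values on diverse triples matter.
Rel3 : ℕ → Set
Rel3 n = Fin n → Fin n → Fin n → Bool

Subset : ℕ → Set
Subset n = Fin n → Bool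

record IsHomogeneous {n : ℕ} (H : Rel3 n) : Set where
  field
    refl'  : ∀ x y → x ≢ y → H x y y ≡ true
    sym'   : ∀ x y z → x ≢ y → x ≢ z → H x y z ≡ true → H x z y ≡ true
    trans' : ∀ x y z w → x ≢ y → x ≢ z → x ≢ w →
             H x y z ≡ true → H x z w ≡ true → H x y w ≡ true

countFin : {n : ℕ} → (Fin n → Bool) → ℕ
countFin {n} p = sum (map (λ i → if p i then 1 else 0) (allFin n))

countList : {A : Set} → (A → Bool) → List A → ℕ
countList p xs = sum (map (λ i → if p i then 1 else 0) xs)

neq : {n : ℕ} → Fin n → Fin n → Bool
neq x y = not ⌊ x ≟ y ⌋

-- Congruence of x w.r.t. the restriction H[A]: the number of equivalence
-- classes of H_x on A ∖ {x}, counted as the number of elements y of A ∖ {x}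
-- which are the least element (in the order of Fin n) of their class.
congruenceOn : {n : ℕ} → Rel3 n → Subset n → Fin n → ℕ
congruenceOn {n} H A x = countFin λ y →
  A y ∧ neq x y ∧
  not (any (λ z → A z ∧ neq x z ∧ ⌊ z <? y ⌋ ∧ H x y z) (allFin n))

congruence : {n : ℕ} → Rel3 n → Fin n → ℕ
congruence H x = congruenceOn H (λ _ → true) x

localCongruence : {n : ℕ} → Rel3 n → ℕ
localCongruence {n} H = foldr _⊔_ 0 (map (congruence H) (allFin n))

triple : {n : ℕ} → Fin n → Fin n → Fin n → Subset n
triple a b c y = ⌊ y ≟ a ⌋ Data.Bool.∨ ⌊ y ≟ b ⌋ Data.Bool.∨ ⌊ y ≟ c ⌋

twos : {n : ℕ} → Rel3 n → Fin n → Fin n → Fin n → ℕ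
twos H a b c = countList (λ v → ⌊ congruenceOn H (triple a b c) v Data.Nat.≟ 2 ⌋)
                         (a ∷ b ∷ c ∷ [])

Distinct3 : {n : ℕ} → Fin n → Fin n → Fin n → Set
Distinct3 a b c = a ≢ b × a ≢ c × b ≢ c

Graphic : {n : ℕ} → Rel3 n → Set
Graphic H = localCongruence H ≤ 2 ×
  (∀ a b c → Distinct3 a b c → twos H a b c ≡ 0 ⊎ twos H a b c ≡ 2)

Tournamental : {n : ℕ} → Rel3 n → Set
Tournamental H = localCongruence H ≤ 2 ×
  (∀ a b c → Distinct3 a b c → twos H a b c ≡ 1 ⊎ twos H a b c ≡ 3)

-- Graphs on X = Fin n by adjacency: E x y = true means an edge (arc) x → y.
-- Undirected (simple) graph: irreflexive and symmetric.
IsGraph : {n : ℕ} → (Fin n → Fin n → Bool) → Set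
IsGraph E = (∀ x → E x x ≡ false) × (∀ x y → E x y ≡ E y x)

IsTournament : {n : ℕ} → (Fin n → Fin n → Bool) → Set
IsTournament E = (∀ x → E x x ≡ false) × (∀ x y → x ≢ y → E x y ≡ not (E y x))

_⇔ᵇ_ : Bool → Bool → Bool
a ⇔ᵇ b = not (a xor b)

stdGraph : {n : ℕ} → (Fin n → Fin n → Bool) → Rel3 n
stdGraph E x u v = E x u ⇔ᵇ E x v

stdDigraph : {n : ℕ} → (Fin n → Fin n → Bool) → Rel3 n
stdDigraph E x u v = (E u x ⇔ᵇ E v x) ∧ (E x u ⇔ᵇ E x v)

_≐_ : {n : ℕ} → Rel3 n → Rel3 n → Set
H ≐ K = ∀ x u v → x ≢ u → x ≢ v → H x u v ≡ K x u v

-- Write t = false for undirected graphs and t = true for tournaments: both are irreflexive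
-- relations E with E x y = t xor E y x for x ≠ y. For such E, each Hₓ = H(E)ₓ has at most the
-- two classes N(x) and its complement, and every triangle satisfies
-- H(c|ab) = t xor (H(a|bc) ⇔ H(b|ac)); since the vertices of congruence 2 in H[{a,b,c}] are those
-- separating the other two, this parity condition is exactly the graphic (resp. tournamental) one.
-- Conversely, with at most two classes H(x|uv) = H(x|uw) ⇔ H(x|vw) for any reference w, so H is
-- the standard relation of E as soon as every neighbourhood N(x) is an Hₓ-class or its
-- complement. Take N(0) to be the H₀-class of 1 and, for x ≠ 0, the Hₓ-class of 0 or its
-- complement as forced by the edge x0; the parity condition on the triangles {0, x, y} is
-- precisely what makes the resulting E satisfy E x y = t xor E y x.

module Submission where

open import Defs
open import Data.Nat using (ℕ; zero; suc; _+_; _≤_; _⊔_; z≤n; s≤s)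
open import Data.Nat.Properties
  using (≤-trans; ≤-pred; ≤⇒≯; ≮⇒≥; m≤m⊔n; m≤n⊔m; ⊔-lub; +-identityʳ; +-commutativeSemigroup)
open import Algebra.Properties.CommutativeSemigroup +-commutativeSemigroup using (x∙yz≈y∙xz)
open import Data.Fin using (Fin; zero; suc; _≟_; _<_; _<?_)
open import Data.Fin.Properties using (<-cmp)
open import Data.Fin.Induction using (<-wellFounded)
open import Data.Bool using (Bool; true; false; not; _∧_; _xor_; if_then_else_)
open import Data.Bool.Properties
  using (∧-assoc; ∧-idem; ∧-conicalˡ; ∧-conicalʳ; ∨-zeroʳ; not-involutive; ¬-not; not-¬; ⇔→≡; T-≡)
  renaming (_≟_ to _≟ᵇ_)
open import Data.List using (List; []; _∷_; map; foldr; allFin; tabulate)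
open import Data.List.Properties using (map-tabulate; map-cong; tabulate-cong)
open import Data.Nat.ListAction using (sum)
open import Data.Bool.ListAction using (any; or)
open import Data.List.Membership.Propositional using (_∈_; lose)
open import Data.List.Membership.Propositional.Properties using (∈-allFin)
open import Data.List.Relation.Unary.Any using (here; there; satisfied)
open import Data.List.Relation.Unary.Any.Properties using (any⁺; any⁻)
open import Data.Product using (_×_; Σ; Σ-syntax; ∃; _,_; uncurry)
open import Data.Product.Function.NonDependent.Propositional using (_×-⇔_)
open import Data.Sum using (_⊎_; inj₁; inj₂; [_,_]′; swap)
open import Data.Empty using (⊥; ⊥-elim)
open import Function using (_∘_; id)
open import Function.Bundles using (_⇔_; mk⇔; Equivalence)
open import Function.Properties.Equivalence using () renaming (sym to ⇔-sym; trans to ⇔-trans)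
open import Induction.WellFounded using (Acc; acc)
open import Relation.Binary using (tri<; tri≈; tri>)
open import Relation.Binary.PropositionalEquality
  using (_≡_; _≢_; refl; sym; trans; cong; cong₂; subst; module ≡-Reasoning)
open import Relation.Nullary using (Dec; yes; no; ¬_; contradiction)
open import Relation.Nullary.Decidable using (⌊_⌋; dec-true; dec-false; isYes≗does; ⌊⌋-map′)

open Equivalence using (to; from)
open ≡-Reasoning

ind : Bool → ℕ
ind b = if b then 1 else 0

⌊⌋-true : {A : Set} (a? : Dec A) → A → ⌊ a? ⌋ ≡ true
⌊⌋-true a? a = trans (isYes≗does a?) (dec-true a? a)

⌊⌋-false : {A : Set} (a? : Dec A) → ¬ A → ⌊ a? ⌋ ≡ false
⌊⌋-false a? ¬a = trans (isYes≗does a?) (dec-false a? ¬a)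

⌊⌋-true⁻ : {A : Set} (a? : Dec A) → ⌊ a? ⌋ ≡ true → A
⌊⌋-true⁻ (yes a) _ = a
⌊⌋-true⁻ (no _)  ()

xor-involutive : ∀ t a → t xor (t xor a) ≡ a
xor-involutive false a = refl
xor-involutive true  a = not-involutive a

⇔ᵇ-identityʳ : ∀ a → (a ⇔ᵇ true) ≡ a
⇔ᵇ-identityʳ false = refl
⇔ᵇ-identityʳ true  = refl

not-⇔ᵇ-not : ∀ a b → (not a ⇔ᵇ not b) ≡ (a ⇔ᵇ b)
not-⇔ᵇ-not false b = cong not (not-involutive b)
not-⇔ᵇ-not true  b = refl

⇔ᵇ-cancelˡ : ∀ e a b → ((e ⇔ᵇ a) ⇔ᵇ (e ⇔ᵇ b)) ≡ (a ⇔ᵇ b)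
⇔ᵇ-cancelˡ false a b = not-⇔ᵇ-not a b
⇔ᵇ-cancelˡ true  a b = cong₂ _⇔ᵇ_ (not-involutive a) (not-involutive b)

⇔ᵇ-pigeonhole : ∀ a b c → (a ⇔ᵇ b) ≡ false → (a ⇔ᵇ c) ≡ false → (b ⇔ᵇ c) ≡ true
⇔ᵇ-pigeonhole false false _     () _
⇔ᵇ-pigeonhole true  true  _     () _
⇔ᵇ-pigeonhole false true  false _  ()
⇔ᵇ-pigeonhole false true  true  _  _  = refl
⇔ᵇ-pigeonhole true  false false _  _  = refl
⇔ᵇ-pigeonhole true  false true  _  ()

-- p, q, r stand for the edges ab, ac, bc of a triangle in a graph twisted by t.
triangle-identity : ∀ t p q r → ((t xor q) ⇔ᵇ (t xor r)) ≡ t xor ((p ⇔ᵇ q) ⇔ᵇ ((t xor p) ⇔ᵇ r))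
triangle-identity false false false false = refl
triangle-identity false false false true  = refl
triangle-identity false false true  false = refl
triangle-identity false false true  true  = refl
triangle-identity false true  false false = refl
triangle-identity false true  false true  = refl
triangle-identity false true  true  false = refl
triangle-identity false true  true  true  = refl
triangle-identity true  false false false = refl
triangle-identity true  false false true  = refl
triangle-identity true  false true  false = refl
triangle-identity true  false true  true  = refl
triangle-identity true  true  false false = refl
triangle-identity true  true  false true  = refl
triangle-identity true  true  true  false = refl
triangle-identity true  true  true  true  = refl

twist-identity : ∀ t p q a → ((t xor p) ⇔ᵇ a) ≡ t xor ((t xor q) ⇔ᵇ (t xor ((p ⇔ᵇ q) ⇔ᵇ a)))
twist-identity false false false false = refl
twist-identity false false false true  = refl
twist-identity false false true  false = refl
twist-identity false false true  true  = refl
twist-identity false true  false false = refl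
twist-identity false true  false true  = refl
twist-identity false true  true  false = refl
twist-identity false true  true  true  = refl
twist-identity true  false false false = refl
twist-identity true  false false true  = refl
twist-identity true  false true  false = refl
twist-identity true  false true  true  = refl
twist-identity true  true  false false = refl
twist-identity true  true  false true  = refl
twist-identity true  true  true  false = refl
twist-identity true  true  true  true  = refl

falseCount : Bool → Bool → Bool → ℕ
falseCount a b c = countList not (a ∷ b ∷ c ∷ [])

ZeroOrTwo OneOrThree : ℕ → Set
ZeroOrTwo  k = k ≡ 0 ⊎ k ≡ 2
OneOrThree k = k ≡ 1 ⊎ k ≡ 3

zeroOrTwo-oneOrThree : ∀ {k} → ZeroOrTwo k → OneOrThree k → ⊥
zeroOrTwo-oneOrThree (inj₁ refl) (inj₁ ())
zeroOrTwo-oneOrThree (inj₁ refl) (inj₂ ())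
zeroOrTwo-oneOrThree (inj₂ refl) (inj₁ ())
zeroOrTwo-oneOrThree (inj₂ refl) (inj₂ ())

falseCount-even : ∀ a b → ZeroOrTwo (falseCount a b (a ⇔ᵇ b))
falseCount-even false false = inj₂ refl
falseCount-even false true  = inj₂ refl
falseCount-even true  false = inj₂ refl
falseCount-even true  true  = inj₁ refl

falseCount-odd : ∀ a b → OneOrThree (falseCount a b (not (a ⇔ᵇ b)))
falseCount-odd false false = inj₂ refl
falseCount-odd false true  = inj₁ refl
falseCount-odd true  false = inj₁ refl
falseCount-odd true  true  = inj₁ refl

zeroOrTwo⇔ : ∀ a b c → ZeroOrTwo (falseCount a b c) ⇔ (c ≡ (a ⇔ᵇ b))
zeroOrTwo⇔ a b c = mk⇔ even⇒ (λ c≡ → subst (ZeroOrTwo ∘ falseCount a b) (sym c≡) (falseCount-even a b))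
  where
  even⇒ : ZeroOrTwo (falseCount a b c) → c ≡ (a ⇔ᵇ b)
  even⇒ even with c ≟ᵇ (a ⇔ᵇ b)
  ... | yes c≡ = c≡
  ... | no  c≢ = ⊥-elim (zeroOrTwo-oneOrThree even
                   (subst (OneOrThree ∘ falseCount a b) (sym (¬-not c≢)) (falseCount-odd a b)))

oneOrThree⇔ : ∀ a b c → OneOrThree (falseCount a b c) ⇔ (c ≡ not (a ⇔ᵇ b))
oneOrThree⇔ a b c = mk⇔ odd⇒ (λ c≡ → subst (OneOrThree ∘ falseCount a b) (sym c≡) (falseCount-odd a b))
  where
  odd⇒ : OneOrThree (falseCount a b c) → c ≡ not (a ⇔ᵇ b)
  odd⇒ odd with c ≟ᵇ (a ⇔ᵇ b)
  ... | no  c≢ = ¬-not c≢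
  ... | yes c≡ = ⊥-elim (zeroOrTwo-oneOrThree
                   (subst (ZeroOrTwo ∘ falseCount a b) (sym c≡) (falseCount-even a b)) odd)

neq-irrefl : ∀ {n} (i : Fin n) → neq i i ≡ false
neq-irrefl i = cong not (⌊⌋-true (i ≟ i) refl)

neq-true : ∀ {n} {i j : Fin n} → i ≢ j → neq i j ≡ true
neq-true {i = i} {j} i≢j = cong not (⌊⌋-false (i ≟ j) i≢j)

neq-true⁻ : ∀ {n} {i j : Fin n} → neq i j ≡ true → i ≢ j
neq-true⁻ {i = i} e refl = not-¬ (neq-irrefl i) e

neq-suc : ∀ {n} (i j : Fin n) → neq (suc i) (suc j) ≡ neq i j
neq-suc i j = cong not (⌊⌋-map′ _ _ (i ≟ j))

count : ∀ {n} → (Fin n → Bool) → ℕ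
count p = sum (tabulate (ind ∘ p))

countFin≡count : ∀ {n} (p : Fin n → Bool) → countFin p ≡ count p
countFin≡count p = cong sum (map-tabulate id (ind ∘ p))

count-cong : ∀ {n} {p q : Fin n → Bool} → (∀ i → p i ≡ q i) → count p ≡ count q
count-cong p≗q = cong sum (tabulate-cong (cong ind ∘ p≗q))

count-split : ∀ {n} (p : Fin n → Bool) (i : Fin n) →
              count p ≡ ind (p i) + count (λ y → neq i y ∧ p y)
count-split p zero    = refl
count-split p (suc i) = begin
  ind (p zero) + count (p ∘ suc)
    ≡⟨ cong (ind (p zero) +_) (count-split (p ∘ suc) i) ⟩
  ind (p zero) + (ind (p (suc i)) + count (λ y → neq i y ∧ p (suc y)))
    ≡⟨ x∙yz≈y∙xz (ind (p zero)) (ind (p (suc i))) (count (λ y → neq i y ∧ p (suc y))) ⟩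
  ind (p (suc i)) + (ind (p zero) + count (λ y → neq i y ∧ p (suc y)))
    ≡⟨ cong (λ c → ind (p (suc i)) + (ind (p zero) + c))
            (count-cong λ y → cong (_∧ p (suc y)) (sym (neq-suc i y))) ⟩
  ind (p (suc i)) + (ind (p zero) + count (λ y → neq (suc i) (suc y) ∧ p (suc y)))  ∎

count-witness : ∀ {n} (p : Fin n → Bool) {i : Fin n} → p i ≡ true →
                count p ≡ suc (count (λ y → neq i y ∧ p y))
count-witness p {i} pi =
  trans (count-split p i) (cong (λ b → ind b + count (λ y → neq i y ∧ p y)) pi)

count-none : ∀ {n} (p : Fin n → Bool) → (∀ i → p i ≡ false) → count p ≡ 0
count-none {zero}  p none = refl
count-none {suc n} p none rewrite none zero = count-none (p ∘ suc) (none ∘ suc)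

count-positive : ∀ {n} (p : Fin n → Bool) → 1 ≤ count p → ∃ λ i → p i ≡ true
count-positive {suc n} p pos with p zero in p0
... | true  = zero , p0
... | false with count-positive (p ∘ suc) pos
...   | i , pi = suc i , pi

3≤count : ∀ {n} (p : Fin n → Bool) {i j k : Fin n} →
          p i ≡ true → p j ≡ true → p k ≡ true → i ≢ j → i ≢ k → j ≢ k → 3 ≤ count p
3≤count p {i} {j} {k} pi pj pk i≢j i≢k j≢k = subst (3 ≤_) (sym count≡) (s≤s (s≤s (s≤s z≤n)))
  where
  p₁ p₂ : Fin _ → Bool
  p₁ y = neq i y ∧ p y
  p₂ y = neq j y ∧ p₁ y
  count≡ : count p ≡ 3 + count (λ y → neq k y ∧ p₂ y)
  count≡ = trans (count-witness p pi)
           (cong suc (trans (count-witness p₁ (cong₂ _∧_ (neq-true i≢j) pj))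
           (cong suc (count-witness p₂ (cong₂ _∧_ (neq-true j≢k) (cong₂ _∧_ (neq-true i≢k) pk))))))

count≤2 : ∀ {n} (p : Fin n → Bool) →
          (∀ {i j k} → p i ≡ true → p j ≡ true → p k ≡ true → i ≢ j → i ≢ k → j ≢ k → ⊥) →
          count p ≤ 2
count≤2 p no-three = ≮⇒≥ λ 3≤p →
  let i , pi = count-positive p (≤-trans (s≤s z≤n) 3≤p)
      p₁ = λ y → neq i y ∧ p y
      2≤p₁ = ≤-pred (subst (3 ≤_) (count-witness p pi) 3≤p)
      j , p₁j = count-positive p₁ (≤-trans (s≤s z≤n) 2≤p₁)
      k , p₂k = count-positive (λ y → neq j y ∧ p₁ y)
                  (≤-pred (subst (2 ≤_) (count-witness p₁ p₁j) 2≤p₁))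
      p₁k = ∧-conicalʳ (neq j k) (p₁ k) p₂k
  in no-three pi (∧-conicalʳ (neq i j) (p j) p₁j) (∧-conicalʳ (neq i k) (p k) p₁k)
       (neq-true⁻ (∧-conicalˡ (neq i j) (p j) p₁j))
       (neq-true⁻ (∧-conicalˡ (neq i k) (p k) p₁k))
       (neq-true⁻ (∧-conicalˡ (neq j k) (p₁ k) p₂k))

count-pair : ∀ {n} (p : Fin n → Bool) {u w : Fin n} → u ≢ w →
             (∀ y → p y ≡ true → y ≡ u ⊎ y ≡ w) → count p ≡ ind (p u) + ind (p w)
count-pair {n} p {u} {w} u≢w support = begin
  count p                                         ≡⟨ count-split p u ⟩
  ind (p u) + count p₁                            ≡⟨ cong (ind (p u) +_) (count-split p₁ w) ⟩
  ind (p u) + (ind (neq u w ∧ p w) + count p₂)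
    ≡⟨ cong₂ (λ a c → ind (p u) + (ind (a ∧ p w) + c)) (neq-true u≢w) (count-none p₂ outside) ⟩
  ind (p u) + (ind (p w) + 0)                     ≡⟨ cong (ind (p u) +_) (+-identityʳ _) ⟩
  ind (p u) + ind (p w)                           ∎
  where
  p₁ p₂ : Fin n → Bool
  p₁ y = neq u y ∧ p y
  p₂ y = neq w y ∧ p₁ y
  outside : ∀ y → p₂ y ≡ false
  outside y = ¬-not λ p₂y →
    let p₁y = ∧-conicalʳ (neq w y) (p₁ y) p₂y
    in [ (λ y≡u → neq-true⁻ (∧-conicalˡ (neq u y) (p y) p₁y) (sym y≡u))
       , (λ y≡w → neq-true⁻ (∧-conicalˡ (neq w y) (p₁ y) p₂y) (sym y≡w))
       ]′ (support y (∧-conicalʳ (neq u y) (p y) p₁y))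

foldr-⊔-≤⇔ : ∀ {A : Set} (f : A → ℕ) (xs : List A) {k : ℕ} →
             foldr _⊔_ 0 (map f xs) ≤ k ⇔ (∀ {x} → x ∈ xs → f x ≤ k)
foldr-⊔-≤⇔ f xs = mk⇔ (bounded xs) (bound xs)
  where
  bounded : ∀ xs {k} → foldr _⊔_ 0 (map f xs) ≤ k → ∀ {x} → x ∈ xs → f x ≤ k
  bounded (y ∷ ys) ≤k (here refl)  = ≤-trans (m≤m⊔n (f y) _) ≤k
  bounded (y ∷ ys) ≤k (there x∈ys) = bounded ys (≤-trans (m≤n⊔m (f y) _) ≤k) x∈ys
  bound : ∀ xs {k} → (∀ {x} → x ∈ xs → f x ≤ k) → foldr _⊔_ 0 (map f xs) ≤ k
  bound []       _   = z≤n
  bound (y ∷ ys) ≤k = ⊔-lub (≤k (here refl)) (bound ys (≤k ∘ there))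

any-allFin⁺ : ∀ {n} (p : Fin n → Bool) {z : Fin n} → p z ≡ true → any p (allFin n) ≡ true
any-allFin⁺ p {z} pz = to T-≡ (any⁺ p (lose (∈-allFin z) (from T-≡ pz)))

any-allFin⁻ : ∀ {n} (p : Fin n → Bool) → any p (allFin n) ≡ true → ∃ λ z → p z ≡ true
any-allFin⁻ {n} p e = let z , pz = satisfied (any⁻ p (allFin n) (from T-≡ e)) in z , to T-≡ pz

any-cong : ∀ {A : Set} {p q : A → Bool} → (∀ x → p x ≡ q x) → ∀ xs → any p xs ≡ any q xs
any-cong p≗q xs = cong or (map-cong p≗q xs)

-- Counting equivalence classes through their least elements

module EquivalenceClasses {n : ℕ} (D : Fin n → Bool) (R : Fin n → Fin n → Bool)
  (R-refl  : ∀ {y} → D y ≡ true → R y y ≡ true)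
  (R-sym   : ∀ {y z} → D y ≡ true → D z ≡ true → R y z ≡ true → R z y ≡ true)
  (R-trans : ∀ {y z w} → D y ≡ true → D z ≡ true → D w ≡ true →
             R y z ≡ true → R z w ≡ true → R y w ≡ true)
  where

  earlierEquivalent : Fin n → Fin n → Bool
  earlierEquivalent y z = D z ∧ ⌊ z <? y ⌋ ∧ R y z

  isLeast : Fin n → Bool
  isLeast y = D y ∧ not (any (earlierEquivalent y) (allFin n))

  classCount : ℕ
  classCount = count isLeast

  least-∈D : ∀ {y} → isLeast y ≡ true → D y ≡ true
  least-∈D {y} = ∧-conicalˡ (D y) _

  least-minimal : ∀ {y z} → isLeast y ≡ true → D z ≡ true → z < y → R y z ≡ false
  least-minimal {y} {z} least Dz z<y = ¬-not λ Ryz →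
    let earlier = cong₂ _∧_ Dz (cong₂ _∧_ (⌊⌋-true (z <? y) z<y) Ryz)
    in not-¬ (cong not (any-allFin⁺ (earlierEquivalent y) earlier)) (∧-conicalʳ (D y) _ least)

  least-representative : ∀ {y} → D y ≡ true → Σ[ m ∈ Fin n ] isLeast m ≡ true × R y m ≡ true
  least-representative {y} = descend y (<-wellFounded y)
    where
    descend : ∀ y → Acc _<_ y → D y ≡ true → Σ[ m ∈ Fin n ] isLeast m ≡ true × R y m ≡ true
    descend y (acc smaller) Dy with any (earlierEquivalent y) (allFin n) in anyEarlier
    ... | false = y , trans (cong (λ b → D y ∧ not b) anyEarlier) (cong (_∧ true) Dy) , R-refl Dy
    ... | true =
      let z , earlier = any-allFin⁻ (earlierEquivalent y) anyEarlier
          Dz = ∧-conicalˡ (D z) _ earlier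
          z<y∧Ryz = ∧-conicalʳ (D z) _ earlier
          z<y = ∧-conicalˡ (⌊ z <? y ⌋) (R y z) z<y∧Ryz
          Ryz = ∧-conicalʳ (⌊ z <? y ⌋) (R y z) z<y∧Ryz
          m , least , Rzm = descend z (smaller (⌊⌋-true⁻ (z <? y) z<y)) Dz
      in m , least , R-trans Dy Dz (least-∈D least) Ryz Rzm

  least-inequivalent : ∀ {i j} → isLeast i ≡ true → isLeast j ≡ true → i ≢ j → R i j ≡ false
  least-inequivalent {i} {j} li lj i≢j with <-cmp i j
  ... | tri< i<j _ _ = ¬-not λ Rij →
          not-¬ (least-minimal lj (least-∈D li) i<j) (R-sym (least-∈D li) (least-∈D lj) Rij)
  ... | tri≈ _ i≡j _ = contradiction i≡j i≢j
  ... | tri> _ _ j<i = least-minimal li (least-∈D lj) j<i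

  representatives-distinct : ∀ {y z m m′} → D y ≡ true → D z ≡ true → isLeast m ≡ true →
                             R y m ≡ true → R z m′ ≡ true → R y z ≡ false → m ≢ m′
  representatives-distinct Dy Dz least Rym Rzm Ryz≡false refl =
    not-¬ Ryz≡false (R-trans Dy (least-∈D least) Dz Rym (R-sym Dz (least-∈D least) Rzm))

  3≤classCount : ∀ {a b c} → D a ≡ true → D b ≡ true → D c ≡ true →
                 R a b ≡ false → R a c ≡ false → R b c ≡ false → 3 ≤ classCount
  3≤classCount Da Db Dc Rab Rac Rbc =
    let ma , la , Ra = least-representative Da
        mb , lb , Rb = least-representative Db
        mc , lc , Rc = least-representative Dc
    in 3≤count isLeast la lb lc
         (representatives-distinct Da Db la Ra Rb Rab)
         (representatives-distinct Da Dc la Ra Rc Rac)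
         (representatives-distinct Db Dc lb Rb Rc Rbc)

  classCount≤2 : (∀ {a b c} → D a ≡ true → D b ≡ true → D c ≡ true →
                  R a b ≡ false → R a c ≡ false → R b c ≡ false → ⊥) → classCount ≤ 2
  classCount≤2 no-three = count≤2 isLeast λ li lj lk i≢j i≢k j≢k →
    no-three (least-∈D li) (least-∈D lj) (least-∈D lk)
      (least-inequivalent li lj i≢j) (least-inequivalent li lk i≢k) (least-inequivalent lj lk j≢k)

  classCount-pair : ∀ {u w} → u ≢ w → D u ≡ true → D w ≡ true →
                    (∀ y → D y ≡ true → y ≡ u ⊎ y ≡ w) → classCount ≡ (if R u w then 1 else 2)
  classCount-pair {u} {w} u≢w Du Dw support =
    trans (count-pair isLeast u≢w (λ y → support y ∘ least-∈D)) counted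
    where
    least-if-alone : ∀ {y z} → D y ≡ true → (∀ x → D x ≡ true → x ≡ y ⊎ x ≡ z) →
                     R y z ≡ false → isLeast y ≡ true
    least-if-alone Dy support′ Ryz with least-representative Dy
    ... | m , lm , Rym with support′ m (least-∈D lm)
    ...   | inj₁ refl = lm
    ...   | inj₂ refl = ⊥-elim (not-¬ Ryz Rym)

    counted : ind (isLeast u) + ind (isLeast w) ≡ (if R u w then 1 else 2)
    counted with R u w in Ruw
    ... | false = cong₂ (λ a b → ind a + ind b)
                    (least-if-alone Du support Ruw)
                    (least-if-alone Dw (λ x → swap ∘ support x) (¬-not λ Rwu → not-¬ Ruw (R-sym Dw Du Rwu)))
    ... | true with isLeast u in lu | isLeast w in lw
    ...   | true  | true  = ⊥-elim (not-¬ (least-inequivalent lu lw u≢w) Ruw)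
    ...   | true  | false = refl
    ...   | false | true  = refl
    ...   | false | false with least-representative Du
    ...     | m , lm , _ with support m (least-∈D lm)
    ...       | inj₁ refl = ⊥-elim (not-¬ lu lm)
    ...       | inj₂ refl = ⊥-elim (not-¬ lw lm)

-- Congruences of a homogeneous relation

triple-∋ : ∀ {n} (a b c y : Fin n) → triple a b c y ≡ true → y ≡ a ⊎ y ≡ b ⊎ y ≡ c
triple-∋ a b c y _ with y ≟ a | y ≟ b | y ≟ c
... | yes y≡a | _       | _       = inj₁ y≡a
... | no _    | yes y≡b | _       = inj₂ (inj₁ y≡b)
... | no _    | no _    | yes y≡c = inj₂ (inj₂ y≡c)
triple-∋ a b c y () | no _ | no _ | no _

⊎-swap₁₂ : {P Q S : Set} → P ⊎ Q ⊎ S → Q ⊎ P ⊎ S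
⊎-swap₁₂ = [ inj₂ ∘ inj₁ , [ inj₁ , inj₂ ∘ inj₂ ]′ ]′

⊎-rotate : {P Q S : Set} → P ⊎ Q ⊎ S → S ⊎ P ⊎ Q
⊎-rotate = [ inj₂ ∘ inj₁ , [ inj₂ ∘ inj₂ , inj₁ ]′ ]′

triple-∋₁ : ∀ {n} (a b c : Fin n) → triple a b c a ≡ true
triple-∋₁ a b c rewrite ⌊⌋-true (a ≟ a) refl = refl

triple-∋₂ : ∀ {n} (a b c : Fin n) → triple a b c b ≡ true
triple-∋₂ a b c rewrite ⌊⌋-true (b ≟ b) refl = ∨-zeroʳ ⌊ b ≟ a ⌋

triple-∋₃ : ∀ {n} (a b c : Fin n) → triple a b c c ≡ true
triple-∋₃ a b c rewrite ⌊⌋-true (c ≟ c) refl | ∨-zeroʳ ⌊ c ≟ b ⌋ = ∨-zeroʳ ⌊ c ≟ a ⌋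

⌊if≟2⌋ : ∀ h → ⌊ (if h then 1 else 2) Data.Nat.≟ 2 ⌋ ≡ not h
⌊if≟2⌋ false = refl
⌊if≟2⌋ true  = refl

IsTwistedGraph : {n : ℕ} → Bool → (Fin n → Fin n → Bool) → Set
IsTwistedGraph t E = (∀ x → E x x ≡ false) × (∀ x y → x ≢ y → E x y ≡ t xor E y x)

TriangleParity : {n : ℕ} → Bool → Rel3 n → Set
TriangleParity t H = ∀ a b c → Distinct3 a b c → H c a b ≡ t xor (H a b c ⇔ᵇ H b a c)

module Homogeneous {n : ℕ} {H : Rel3 n} (hom : IsHomogeneous H) where
  open IsHomogeneous hom

  H-comm : ∀ {x u v} → x ≢ u → x ≢ v → H x u v ≡ H x v u
  H-comm {x} {u} {v} x≢u x≢v = ⇔→≡ (mk⇔ (sym' x u v x≢u x≢v) (sym' x v u x≢v x≢u))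

  apart : ∀ {A : Subset n} {x y} → A y ∧ neq x y ≡ true → x ≢ y
  apart {A} {x} {y} = neq-true⁻ ∘ ∧-conicalʳ (A y) (neq x y)

  module Classes (A : Subset n) (x : Fin n) = EquivalenceClasses (λ y → A y ∧ neq x y) (H x)
    (λ Dy → refl' x _ (apart {A} Dy))
    (λ Dy Dz → sym' x _ _ (apart {A} Dy) (apart {A} Dz))
    (λ Dy Dz Dw → trans' x _ _ _ (apart {A} Dy) (apart {A} Dz) (apart {A} Dw))

  congruenceOn≡classCount : ∀ A x → congruenceOn H A x ≡ Classes.classCount A x
  congruenceOn≡classCount A x = trans (countFin≡count {n} _) (count-cong λ y →
    trans (cong (λ b → A y ∧ neq x y ∧ not b) (any-cong (λ z → sym (∧-assoc (A z) (neq x z) _)) (allFin n)))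
          (sym (∧-assoc (A y) (neq x y) _)))

  3≤congruence : ∀ {x a b c} → x ≢ a → x ≢ b → x ≢ c →
                 H x a b ≡ false → H x a c ≡ false → H x b c ≡ false → 3 ≤ congruence H x
  3≤congruence {x} x≢a x≢b x≢c Hab Hac Hbc =
    subst (3 ≤_) (sym (congruenceOn≡classCount _ x))
      (Classes.3≤classCount _ x (neq-true x≢a) (neq-true x≢b) (neq-true x≢c) Hab Hac Hbc)

  congruence≤2 : ∀ {x} → (∀ {a b c} → x ≢ a → x ≢ b → x ≢ c →
                          H x a b ≡ false → H x a c ≡ false → H x b c ≡ false → ⊥) →
                 congruence H x ≤ 2
  congruence≤2 {x} no-three =
    subst (_≤ 2) (sym (congruenceOn≡classCount _ x))
      (Classes.classCount≤2 _ x λ Da Db Dc → no-three (neq-true⁻ Da) (neq-true⁻ Db) (neq-true⁻ Dc))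

  congruenceOn-triangle : ∀ {A x u w} → Distinct3 x u w →
                          (∀ y → A y ≡ true → y ≡ x ⊎ y ≡ u ⊎ y ≡ w) → A u ≡ true → A w ≡ true →
                          congruenceOn H A x ≡ (if H x u w then 1 else 2)
  congruenceOn-triangle {A} {x} {u} {w} (x≢u , x≢w , u≢w) ∈A Au Aw =
    trans (congruenceOn≡classCount A x)
          (Classes.classCount-pair A x u≢w (cong₂ _∧_ Au (neq-true x≢u)) (cong₂ _∧_ Aw (neq-true x≢w))
             λ y Dy → [ (λ y≡x → contradiction (sym y≡x) (apart {A} Dy)) , id ]′
                        (∈A y (∧-conicalˡ (A y) (neq x y) Dy)))

  twos≡falseCount : ∀ {a b c} → Distinct3 a b c →
                    twos H a b c ≡ falseCount (H a b c) (H b a c) (H c a b)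
  twos≡falseCount {a} {b} {c} (a≢b , a≢c , b≢c)
    rewrite congruenceOn-triangle (a≢b , a≢c , b≢c) (triple-∋ a b c) (triple-∋₂ a b c) (triple-∋₃ a b c)
          | congruenceOn-triangle (a≢b ∘ sym , b≢c , a≢c) (λ y → ⊎-swap₁₂ ∘ triple-∋ a b c y)
              (triple-∋₁ a b c) (triple-∋₃ a b c)
          | congruenceOn-triangle (a≢c ∘ sym , b≢c ∘ sym , a≢b) (λ y → ⊎-rotate ∘ triple-∋ a b c y)
              (triple-∋₁ a b c) (triple-∋₂ a b c)
          | ⌊if≟2⌋ (H a b c) | ⌊if≟2⌋ (H b a c) | ⌊if≟2⌋ (H c a b)
          = refl

  localCongruence≤⇔ : ∀ k → localCongruence H ≤ k ⇔ (∀ x → congruence H x ≤ k)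
  localCongruence≤⇔ k = ⇔-trans (foldr-⊔-≤⇔ (congruence H) (allFin n))
                                (mk⇔ (λ ≤k x → ≤k (∈-allFin x)) (λ ≤k {x} _ → ≤k x))

  ⇔ᵇ-reference : ∀ {x u v w} → congruence H x ≤ 2 → x ≢ u → x ≢ v → x ≢ w →
                 H x u v ≡ (H x u w ⇔ᵇ H x v w)
  ⇔ᵇ-reference {x} {u} {v} {w} ≤2 x≢u x≢v x≢w with H x u w in Huw | H x v w in Hvw
  ... | true  | true  = trans' x u w v x≢u x≢w x≢v Huw (sym' x v w x≢v x≢w Hvw)
  ... | true  | false = ¬-not λ Huv → not-¬ Hvw (trans' x v u w x≢v x≢u x≢w (sym' x u v x≢u x≢v Huv) Huw)
  ... | false | true  = ¬-not λ Huv → not-¬ Huw (trans' x u v w x≢u x≢v x≢w Huv Hvw)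
  ... | false | false = ¬-not λ Huv → ≤⇒≯ ≤2 (3≤congruence x≢u x≢v x≢w Huv Huw Hvw)

  triangles⇔ : ∀ t (P : ℕ → Set) → (∀ a b c → P (falseCount a b c) ⇔ (c ≡ t xor (a ⇔ᵇ b))) →
               (∀ a b c → Distinct3 a b c → P (twos H a b c)) ⇔ TriangleParity t H
  triangles⇔ t P P⇔ = mk⇔
    (λ twos∈P a b c abc → to (P⇔ (H a b c) (H b a c) (H c a b))
                               (subst P (twos≡falseCount abc) (twos∈P a b c abc)))
    (λ parity a b c abc → subst P (sym (twos≡falseCount abc))
                               (from (P⇔ (H a b c) (H b a c) (H c a b)) (parity a b c abc)))

  graphic⇔ : Graphic H ⇔ ((∀ x → congruence H x ≤ 2) × TriangleParity false H)
  graphic⇔ = localCongruence≤⇔ 2 ×-⇔ triangles⇔ false ZeroOrTwo zeroOrTwo⇔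

  tournamental⇔ : Tournamental H ⇔ ((∀ x → congruence H x ≤ 2) × TriangleParity true H)
  tournamental⇔ = localCongruence≤⇔ 2 ×-⇔ triangles⇔ true OneOrThree oneOrThree⇔

  standard⇒ : ∀ {t} → (Σ[ E ∈ (Fin n → Fin n → Bool) ] IsTwistedGraph t E × H ≐ stdGraph E) →
              (∀ x → congruence H x ≤ 2) × TriangleParity t H
  standard⇒ {t} (E , (_ , twisted) , H≐E) = at-most-two-classes , parity
    where
    at-most-two-classes : ∀ x → congruence H x ≤ 2
    at-most-two-classes x = congruence≤2 λ {a b c} x≢a x≢b x≢c Hab Hac Hbc →
      not-¬ (trans (sym (H≐E x b c x≢b x≢c)) Hbc)
            (⇔ᵇ-pigeonhole (E x a) (E x b) (E x c)
               (trans (sym (H≐E x a b x≢a x≢b)) Hab) (trans (sym (H≐E x a c x≢a x≢c)) Hac))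

    parity : TriangleParity t H
    parity a b c (a≢b , a≢c , b≢c) = begin
      H c a b                                              ≡⟨ H≐E c a b (a≢c ∘ sym) (b≢c ∘ sym) ⟩
      E c a ⇔ᵇ E c b                                       ≡⟨ cong₂ _⇔ᵇ_ (twisted c a (a≢c ∘ sym))
                                                                         (twisted c b (b≢c ∘ sym)) ⟩
      (t xor E a c) ⇔ᵇ (t xor E b c)                       ≡⟨ triangle-identity t (E a b) (E a c) (E b c) ⟩
      t xor ((E a b ⇔ᵇ E a c) ⇔ᵇ ((t xor E a b) ⇔ᵇ E b c)) ≡⟨ cong (λ e → t xor ((E a b ⇔ᵇ E a c) ⇔ᵇ (e ⇔ᵇ E b c)))
                                                                 (sym (twisted b a (a≢b ∘ sym))) ⟩
      t xor ((E a b ⇔ᵇ E a c) ⇔ᵇ (E b a ⇔ᵇ E b c))         ≡⟨ cong (t xor_) (sym (cong₂ _⇔ᵇ_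
                                                                 (H≐E a b c a≢b a≢c) (H≐E b a c (a≢b ∘ sym) b≢c))) ⟩
      t xor (H a b c ⇔ᵇ H b a c)                           ∎

-- Reconstructing the graph

module Reconstruction {m : ℕ} {H : Rel3 (suc (suc m))} (hom : IsHomogeneous H) (t : Bool)
  (two-classes : ∀ x → congruence H x ≤ 2) (parity : TriangleParity t H) where
  open IsHomogeneous hom
  open Homogeneous hom

  E : Fin (suc (suc m)) → Fin (suc (suc m)) → Bool
  E zero    zero    = false
  E zero    (suc j) = H zero (suc j) (suc zero)
  E (suc i) u       = if ⌊ suc i ≟ u ⌋ then false else ((t xor E zero (suc i)) ⇔ᵇ H (suc i) u zero)

  E-irrefl : ∀ x → E x x ≡ false
  E-irrefl zero    = refl
  E-irrefl (suc i) rewrite ⌊⌋-true (suc i ≟ suc i) refl = refl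

  E-suc : ∀ {i u} → suc i ≢ u → E (suc i) u ≡ ((t xor E zero (suc i)) ⇔ᵇ H (suc i) u zero)
  E-suc {i} {u} i≢u rewrite ⌊⌋-false (suc i ≟ u) i≢u = refl

  E-to-zero : ∀ i → E (suc i) zero ≡ t xor E zero (suc i)
  E-to-zero i = begin
    E (suc i) zero                                  ≡⟨ E-suc (λ ()) ⟩
    (t xor E zero (suc i)) ⇔ᵇ H (suc i) zero zero   ≡⟨ cong ((t xor E zero (suc i)) ⇔ᵇ_) (refl' (suc i) zero (λ ())) ⟩
    (t xor E zero (suc i)) ⇔ᵇ true                  ≡⟨ ⇔ᵇ-identityʳ _ ⟩
    t xor E zero (suc i)                            ∎

  H₀≐E : ∀ {u v} → zero ≢ u → zero ≢ v → H zero u v ≡ (E zero u ⇔ᵇ E zero v)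
  H₀≐E {zero}  {_}     0≢u _   = contradiction refl 0≢u
  H₀≐E {suc j} {zero}  _   0≢v = contradiction refl 0≢v
  H₀≐E {suc j} {suc k} _   _   = ⇔ᵇ-reference (two-classes zero) (λ ()) (λ ()) (λ ())

  H≐E : H ≐ stdGraph E
  H≐E zero    u v 0≢u 0≢v = H₀≐E 0≢u 0≢v
  H≐E (suc i) u v x≢u x≢v = begin
    H (suc i) u v                                   ≡⟨ ⇔ᵇ-reference (two-classes (suc i)) x≢u x≢v (λ ()) ⟩
    H (suc i) u zero ⇔ᵇ H (suc i) v zero            ≡⟨ sym (⇔ᵇ-cancelˡ (t xor E zero (suc i)) _ _) ⟩
    ((t xor E zero (suc i)) ⇔ᵇ H (suc i) u zero) ⇔ᵇ ((t xor E zero (suc i)) ⇔ᵇ H (suc i) v zero)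
                                                    ≡⟨ sym (cong₂ _⇔ᵇ_ (E-suc x≢u) (E-suc x≢v)) ⟩
    E (suc i) u ⇔ᵇ E (suc i) v                      ∎

  E-twisted : ∀ x y → x ≢ y → E x y ≡ t xor E y x
  E-twisted zero    zero    x≢y = contradiction refl x≢y
  E-twisted zero    (suc j) _   = trans (sym (xor-involutive t _)) (cong (t xor_) (sym (E-to-zero j)))
  E-twisted (suc i) zero    _   = E-to-zero i
  E-twisted (suc i) (suc j) x≢y = begin
    E x y                                                       ≡⟨ E-suc x≢y ⟩
    (t xor E zero x) ⇔ᵇ H x y zero                              ≡⟨ twist-identity t (E zero x) (E zero y) (H x y zero) ⟩
    t xor ((t xor E zero y) ⇔ᵇ (t xor ((E zero x ⇔ᵇ E zero y) ⇔ᵇ H x y zero)))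
                                                                ≡⟨ cong (λ h → t xor ((t xor E zero y) ⇔ᵇ h)) (sym Hyx0) ⟩
    t xor ((t xor E zero y) ⇔ᵇ H y x zero)                      ≡⟨ cong (t xor_) (sym (E-suc (x≢y ∘ sym))) ⟩
    t xor E y x                                                 ∎
    where
    x y : Fin (suc (suc m))
    x = suc i
    y = suc j
    Hyx0 : H y x zero ≡ t xor ((E zero x ⇔ᵇ E zero y) ⇔ᵇ H x y zero)
    Hyx0 = begin
      H y x zero                           ≡⟨ H-comm (x≢y ∘ sym) (λ ()) ⟩
      H y zero x                           ≡⟨ parity zero x y ((λ ()) , (λ ()) , x≢y) ⟩
      t xor (H zero x y ⇔ᵇ H x zero y)     ≡⟨ cong (t xor_) (cong₂ _⇔ᵇ_ (H₀≐E (λ ()) (λ ())) (H-comm (λ ()) x≢y)) ⟩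
      t xor ((E zero x ⇔ᵇ E zero y) ⇔ᵇ H x y zero) ∎

standard⇐ : ∀ {n} {H : Rel3 n} → IsHomogeneous H → ∀ t →
            (∀ x → congruence H x ≤ 2) → TriangleParity t H →
            Σ[ E ∈ (Fin n → Fin n → Bool) ] IsTwistedGraph t E × H ≐ stdGraph E
standard⇐ {zero}        _   _ _ _ = (λ _ _ → false) , ((λ ()) , λ ()) , λ ()
standard⇐ {suc zero}    _   _ _ _ =
  (λ _ _ → false) , ((λ _ → refl) , λ { zero zero x≢y → contradiction refl x≢y })
  , λ { zero zero _ x≢u _ → contradiction refl x≢u }
standard⇐ {suc (suc m)} hom t two-classes parity = E , (E-irrefl , E-twisted) , H≐E
  where open Reconstruction hom t two-classes parity

standard⇔ : ∀ {n} {H : Rel3 n} → IsHomogeneous H → ∀ t →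
            (Σ[ E ∈ (Fin n → Fin n → Bool) ] IsTwistedGraph t E × H ≐ stdGraph E) ⇔
            ((∀ x → congruence H x ≤ 2) × TriangleParity t H)
standard⇔ hom t = mk⇔ (Homogeneous.standard⇒ hom {t}) (uncurry (standard⇐ hom t))

-- Graphs and tournaments

graphs⇔ : ∀ {n} {H : Rel3 n} →
          (Σ[ E ∈ (Fin n → Fin n → Bool) ] IsGraph E × H ≐ stdGraph E) ⇔
          (Σ[ E ∈ (Fin n → Fin n → Bool) ] IsTwistedGraph false E × H ≐ stdGraph E)
graphs⇔ = mk⇔ (λ (E , (irrefl , E-sym) , H≐E) → E , (irrefl , λ x y _ → E-sym x y) , H≐E)
              (λ (E , (irrefl , twisted) , H≐E) → E , (irrefl , symmetric twisted) , H≐E)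
  where
  symmetric : ∀ {n} {E : Fin n → Fin n → Bool} →
              (∀ x y → x ≢ y → E x y ≡ E y x) → ∀ x y → E x y ≡ E y x
  symmetric twisted x y with x ≟ y
  ... | yes refl = refl
  ... | no  x≢y  = twisted x y x≢y

stdDigraph≡stdGraph : ∀ {n} {E : Fin n → Fin n → Bool} → IsTournament E →
                      ∀ {x u v} → x ≢ u → x ≢ v → stdDigraph E x u v ≡ stdGraph E x u v
stdDigraph≡stdGraph {E = E} (_ , anti) {x} {u} {v} x≢u x≢v = begin
  (E u x ⇔ᵇ E v x) ∧ (E x u ⇔ᵇ E x v)
    ≡⟨ cong₂ (λ a b → (a ⇔ᵇ b) ∧ (E x u ⇔ᵇ E x v)) (anti u x (x≢u ∘ sym)) (anti v x (x≢v ∘ sym)) ⟩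
  (not (E x u) ⇔ᵇ not (E x v)) ∧ (E x u ⇔ᵇ E x v)
    ≡⟨ cong (_∧ (E x u ⇔ᵇ E x v)) (not-⇔ᵇ-not (E x u) (E x v)) ⟩
  (E x u ⇔ᵇ E x v) ∧ (E x u ⇔ᵇ E x v)
    ≡⟨ ∧-idem _ ⟩
  E x u ⇔ᵇ E x v ∎

tournaments⇔ : ∀ {n} {H : Rel3 n} →
               (Σ[ E ∈ (Fin n → Fin n → Bool) ] IsTournament E × H ≐ stdDigraph E) ⇔
               (Σ[ E ∈ (Fin n → Fin n → Bool) ] IsTwistedGraph true E × H ≐ stdGraph E)
tournaments⇔ = mk⇔
  (λ (E , τ , H≐E) → E , τ , λ x u v x≢u x≢v → trans (H≐E x u v x≢u x≢v) (stdDigraph≡stdGraph τ x≢u x≢v))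
  (λ (E , τ , H≐E) → E , τ , λ x u v x≢u x≢v → trans (H≐E x u v x≢u x≢v) (sym (stdDigraph≡stdGraph τ x≢u x≢v)))

theorem3 : (n : ℕ) (H : Rel3 n) → IsHomogeneous H →
    ((Σ (Fin n → Fin n → Bool) λ E → IsGraph E × (H ≐ stdGraph E)) ⇔ Graphic H)
    × ((Σ (Fin n → Fin n → Bool) λ E → IsTournament E × (H ≐ stdDigraph E)) ⇔ Tournamental H)
theorem3 n H hom =
    ⇔-trans graphs⇔      (⇔-trans (standard⇔ hom false) (⇔-sym graphic⇔))
  , ⇔-trans tournaments⇔ (⇔-trans (standard⇔ hom true)  (⇔-sym tournamental⇔))
  where open Homogeneous hom
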